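{- Let $G$ be a finite graph on $n$ vertices and $k$ a natural number, and let $\mathcal{B}$ be either $\mathcal{B}(G)$, or $\mathcal{B}_{\geq k}(G)$ with $k\le n-1$. Let $P\in V(\mathcal{B})$. If $P$ has two distinct parts of size $2$ with no edges of $G$ between them, then $P$ does not satisfy Property 1.
   Context: An independent set partition of $G$ is a partition of $V(G)$ into nonempty independent sets (parts). For such a partition $P$ and $v\in V(G)$, let $P-v$ be the partition of $V(G)\setminus\{v\}$ obtained by deleting $v$ from its part (discarding that part if empty). The Bell colouring graph $\mathcal{B}(G)$ has as vertices the independent set partitions of $G$, with $P\neq Q$ adjacent iff $P-v=Q-v$ for some $v\in V(G)$; $\mathcal{B}_{\geq k}(G)$ is its induced subgraph on partitions with at least $k$ parts. For $P\in V(\mathcal{B})$, $N(P)$ is its set of neighbours in $\mathcal{B}$ and $N[P]=N(P)\cup\{P\}$. Property 1 (of $P$ in $\mathcal{B}$): any two neighbours of $P$ which are not adjacent to each other have exactly one common neighbour $R$ in $\mathcal{B}$ outside $N[P]$, and no other neighbour of $P$ is adjacent to $R$. -}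

module Defs where

open import Data.Nat using (ℕ; _≤_; _∸_; _<ᵇ_)
open import Data.Fin using (Fin; toℕ)
open import Data.Bool using (Bool; true; false; not; _∧_; if_then_else_)
open import Data.List using (List; map; allFin)
open import Data.Bool.ListAction using (any)
open import Data.Nat.ListAction using (sum)
open import Data.Maybe using (Maybe; just; nothing)
open import Data.Product using (Σ; ∃; ∃-syntax; _×_; _,_)
open import Data.Sum using (_⊎_)
open import Data.Unit using (⊤)
open import Relation.Nullary using (¬_)
open import Relation.Binary.PropositionalEquality using (_≡_; _≢_)

record Graph (n : ℕ) : Set where
  field
    E      : Fin n → Fin n → Bool
    E-sym  : ∀ u v → E u v ≡ E v u
    E-irr  : ∀ v → E v v ≡ false
open Graph public

-- A set partition of Fin n, represented by its equivalence relation
-- "u and v lie in the same part". (Parts = equivalence classes; they are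
-- automatically nonempty.)  Two partitions are equal iff they have the
-- same relation (see _≈P_).
record Partition (n : ℕ) : Set where
  field
    same       : Fin n → Fin n → Bool
    same-refl  : ∀ v → same v v ≡ true
    same-sym   : ∀ u v → same u v ≡ same v u
    same-trans : ∀ u v w → same u v ≡ true → same v w ≡ true → same u w ≡ true
open Partition public

_≈P_ : ∀ {n} → Partition n → Partition n → Set
P ≈P Q = ∀ u v → same P u v ≡ same Q u v

Independent : ∀ {n} → Graph n → Partition n → Set
Independent G P = ∀ u v → same P u v ≡ true → E G u v ≡ false

isLeast : ∀ {n} → Partition n → Fin n → Bool
isLeast {n} P v = not (any (λ u → (toℕ u <ᵇ toℕ v) ∧ same P u v) (allFin n))

numParts : ∀ {n} → Partition n → ℕ
numParts {n} P = sum (map (λ v → if isLeast P v then 1 else 0) (allFin n))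

AgreeOff : ∀ {n} → Fin n → Partition n → Partition n → Set
AgreeOff x P Q = ∀ u w → u ≢ x → w ≢ x → same P u w ≡ same Q u w

-- adjacency in the Bell colouring graph (on all set partitions; the
-- subgraphs B(G), B_{≥k}(G) are induced, so adjacency is the same)
BAdj : ∀ {n} → Partition n → Partition n → Set
BAdj P Q = ¬ (P ≈P Q) × ∃[ x ] AgreeOff x P Q

-- Which Bell colouring graph: nothing = B(G), just k = B_{≥k}(G)
-- Vertex set of the chosen graph:
InB : ∀ {n} → Graph n → Maybe ℕ → Partition n → Set
InB G nothing  P = Independent G P
InB G (just k) P = Independent G P × k ≤ numParts P

ValidVariant : ℕ → Maybe ℕ → Set
ValidVariant n nothing  = ⊤
ValidVariant n (just k) = k ≤ n ∸ 1

Property1 : ∀ {n} → Graph n → Maybe ℕ → Partition n → Set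
Property1 G b P =
  ∀ Q₁ Q₂ → InB G b Q₁ → InB G b Q₂ → BAdj P Q₁ → BAdj P Q₂ →
  ¬ (Q₁ ≈P Q₂) → ¬ BAdj Q₁ Q₂ →
  Σ (Partition _) λ R →
    (InB G b R × ¬ (R ≈P P) × ¬ BAdj P R × BAdj Q₁ R × BAdj Q₂ R) ×
    (∀ R′ → InB G b R′ → ¬ (R′ ≈P P) → ¬ BAdj P R′ → BAdj Q₁ R′ → BAdj Q₂ R′ →
       R′ ≈P R) ×
    (∀ Q → InB G b Q → BAdj P Q → BAdj Q R → (Q ≈P Q₁) ⊎ (Q ≈P Q₂))

PartOfSize2 : ∀ {n} → Partition n → Fin n → Fin n → Set
PartOfSize2 P a b = a ≢ b × same P a b ≡ true × (∀ c → same P a c ≡ true → c ≡ a ⊎ c ≡ b)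

TwoNonAdjacentPairs : ∀ {n} → Graph n → Partition n → Set
TwoNonAdjacentPairs G P =
  ∃[ a ] ∃[ b ] ∃[ c ] ∃[ d ]
    PartOfSize2 P a b × PartOfSize2 P c d × same P a c ≡ false ×
    E G a c ≡ false × E G a d ≡ false × E G b c ≡ false × E G b d ≡ false

{-# OPTIONS --safe #-}
module Submission where

-- Let {a, b} and {c, d} be the two parts. Splitting b off and splitting d off give two
-- non-adjacent neighbours Q₁, Q₂ of P. Both R₁, in which a, b, c, d are singletons, and R₂,
-- which moreover joins the larger vertex of {a, b} with the larger vertex of {c, d}, are common
-- neighbours of Q₁ and Q₂ outside N[P], so the common neighbour is not unique. As a, b, c, d
-- are pairwise non-adjacent these partitions are independent, and as only larger vertices are
-- joined the least vertex of every part of P stays least in its new part, so none of them has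
-- fewer parts than P.
--
-- All of them agree with P off {a, b, c, d}, which is a union of parts of P. Replacing P there
-- by a partition of Fin 4 embeds the Bell graph of Fin 4 as an induced subgraph, so every
-- adjacency needed is decided by evaluation on partitions of Fin 4.

open import Defs
open import Data.Nat using (ℕ; _≤_; _<_; _<ᵇ_; z≤n)
open import Data.Nat.Properties using (<ᵇ⇒<; <⇒<ᵇ; <-cmp; ≤-refl; ≤-trans; +-mono-≤)
import Data.Nat.Properties as ℕ
open import Data.Fin using (Fin; toℕ; _≟_)
open import Data.Fin.Patterns using (0F; 1F; 2F; 3F)
open import Data.Fin.Properties using (toℕ-injective; any?; all?)
open import Data.Vec.Functional using ([]; _∷_)
open import Data.Bool using (Bool; true; false; not; _∧_; T; if_then_else_)
open import Data.Bool.Properties using (T-≡; T-∧; ¬-not)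
import Data.Bool.Properties as Bool
open import Data.List using (map; allFin)
import Data.List as List
open import Data.List.Relation.Unary.Any using (satisfied)
open import Data.List.Relation.Unary.Any.Properties using (any⁺; any⁻)
open import Data.List.Membership.Propositional using (lose)
open import Data.List.Membership.Propositional.Properties using (∈-allFin)
open import Data.Bool.ListAction using (any)
open import Data.Nat.ListAction using (sum)
open import Data.Maybe using (Maybe; just; nothing)
open import Data.Product using (∃-syntax; _×_; _,_)
open import Data.Sum using (_⊎_; inj₁; inj₂; [_,_]′)
open import Data.Empty using (⊥-elim)
open import Function using (_∘_; id; Injective; Equivalence; mk⇔)
open import Relation.Nullary using (¬_; Dec; yes; no; does; ¬?; contradiction)
open import Relation.Nullary.Decidable using (map′; _×-dec_; _→-dec_; from-yes; dec-true; does-⇔)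
open import Relation.Binary using (tri<; tri≈; tri>)
open import Relation.Binary.PropositionalEquality using (_≡_; _≢_; refl; sym; trans; cong; cong₂)

private
  variable
    n k : ℕ

BAdj-respˡ : ∀ {P P′ Q : Partition n} → P ≈P P′ → BAdj P Q → BAdj P′ Q
BAdj-respˡ P≈P′ (P≉Q , x , agree) =
  (λ P′≈Q → P≉Q λ u v → trans (P≈P′ u v) (P′≈Q u v)) ,
  x , λ u w u≢x w≢x → trans (sym (P≈P′ u w)) (agree u w u≢x w≢x)

_≈P?_ : (P Q : Partition n) → Dec (P ≈P Q)
P ≈P? Q = all? λ u → all? λ v → same P u v Bool.≟ same Q u v

agreeOff? : (x : Fin n) (P Q : Partition n) → Dec (AgreeOff x P Q)
agreeOff? x P Q = all? λ u → all? λ w →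
  ¬? (u ≟ x) →-dec ¬? (w ≟ x) →-dec same P u w Bool.≟ same Q u w

bAdj? : (P Q : Partition n) → Dec (BAdj P Q)
bAdj? P Q = ¬? (P ≈P? Q) ×-dec any? λ x → agreeOff? x P Q

record NonAdjacentNeighbours (P Q₁ Q₂ : Partition n) : Set where
  constructor nonAdjacentNeighbours
  field
    P-Q₁  : BAdj P Q₁
    P-Q₂  : BAdj P Q₂
    Q₁≉Q₂ : ¬ (Q₁ ≈P Q₂)
    Q₁≁Q₂ : ¬ BAdj Q₁ Q₂

record OutsideCommonNeighbour (P Q₁ Q₂ R : Partition n) : Set where
  constructor outsideCommonNeighbour
  field
    R≉P  : ¬ (R ≈P P)
    P≁R  : ¬ BAdj P R
    Q₁-R : BAdj Q₁ R
    Q₂-R : BAdj Q₂ R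

nonAdjacentNeighbours? : (P Q₁ Q₂ : Partition n) → Dec (NonAdjacentNeighbours P Q₁ Q₂)
nonAdjacentNeighbours? P Q₁ Q₂ =
  map′ (λ (PQ₁ , PQ₂ , Q₁≉Q₂ , Q₁≁Q₂) → nonAdjacentNeighbours PQ₁ PQ₂ Q₁≉Q₂ Q₁≁Q₂)
       (λ (nonAdjacentNeighbours PQ₁ PQ₂ Q₁≉Q₂ Q₁≁Q₂) → PQ₁ , PQ₂ , Q₁≉Q₂ , Q₁≁Q₂)
       (bAdj? P Q₁ ×-dec bAdj? P Q₂ ×-dec ¬? (Q₁ ≈P? Q₂) ×-dec ¬? (bAdj? Q₁ Q₂))

outsideCommonNeighbour? : (P Q₁ Q₂ R : Partition n) → Dec (OutsideCommonNeighbour P Q₁ Q₂ R)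
outsideCommonNeighbour? P Q₁ Q₂ R =
  map′ (λ (R≉P , P≁R , Q₁R , Q₂R) → outsideCommonNeighbour R≉P P≁R Q₁R Q₂R)
       (λ (outsideCommonNeighbour R≉P P≁R Q₁R Q₂R) → R≉P , P≁R , Q₁R , Q₂R)
       (¬? (R ≈P? P) ×-dec ¬? (bAdj? P R) ×-dec bAdj? Q₁ R ×-dec bAdj? Q₂ R)

nonAdjacentNeighbours-respˡ : ∀ {P P′ Q₁ Q₂ : Partition n} →
  P ≈P P′ → NonAdjacentNeighbours P Q₁ Q₂ → NonAdjacentNeighbours P′ Q₁ Q₂
nonAdjacentNeighbours-respˡ {P = P} {P′} {Q₁} {Q₂} P≈P′
  (nonAdjacentNeighbours PQ₁ PQ₂ Q₁≉Q₂ Q₁≁Q₂) =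
  nonAdjacentNeighbours (BAdj-respˡ {P = P} {P′} {Q₁} P≈P′ PQ₁)
                        (BAdj-respˡ {P = P} {P′} {Q₂} P≈P′ PQ₂) Q₁≉Q₂ Q₁≁Q₂

outsideCommonNeighbour-respˡ : ∀ {P P′ Q₁ Q₂ R : Partition n} →
  P ≈P P′ → OutsideCommonNeighbour P Q₁ Q₂ R → OutsideCommonNeighbour P′ Q₁ Q₂ R
outsideCommonNeighbour-respˡ {P = P} {P′} {R = R} P≈P′ (outsideCommonNeighbour R≉P P≁R Q₁R Q₂R) =
  outsideCommonNeighbour (λ R≈P′ → R≉P λ u v → trans (R≈P′ u v) (sym (P≈P′ u v)))
                         (P≁R ∘ BAdj-respˡ {P = P′} {P} {R} (λ u v → sym (P≈P′ u v))) Q₁R Q₂R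

outsideCommonNeighbours⇒¬Property1 : ∀ {G : Graph n} {b} {P Q₁ Q₂ R₁ R₂ : Partition n} →
  InB G b Q₁ → InB G b Q₂ → NonAdjacentNeighbours P Q₁ Q₂ →
  InB G b R₁ → InB G b R₂ →
  OutsideCommonNeighbour P Q₁ Q₂ R₁ → OutsideCommonNeighbour P Q₁ Q₂ R₂ →
  ¬ (R₁ ≈P R₂) → ¬ Property1 G b P
outsideCommonNeighbours⇒¬Property1 {Q₁ = Q₁} {Q₂} {R₁} {R₂}
  Q₁∈B Q₂∈B (nonAdjacentNeighbours PQ₁ PQ₂ Q₁≉Q₂ Q₁≁Q₂) R₁∈B R₂∈B
  (outsideCommonNeighbour R₁≉P P≁R₁ Q₁R₁ Q₂R₁) (outsideCommonNeighbour R₂≉P P≁R₂ Q₁R₂ Q₂R₂)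
  R₁≉R₂ property1
  with property1 Q₁ Q₂ Q₁∈B Q₂∈B PQ₁ PQ₂ Q₁≉Q₂ Q₁≁Q₂
... | R , _ , unique , _ = R₁≉R₂ λ u v → trans (R₁≈R u v) (sym (R₂≈R u v))
  where
  R₁≈R : R₁ ≈P R
  R₁≈R = unique R₁ R₁∈B R₁≉P P≁R₁ Q₁R₁ Q₂R₁
  R₂≈R : R₂ ≈P R
  R₂≈R = unique R₂ R₂∈B R₂≉P P≁R₂ Q₁R₂ Q₂R₂

earlier⇒¬isLeast : ∀ {P : Partition n} {u v} →
                   toℕ u < toℕ v → same P u v ≡ true → isLeast P v ≡ false
earlier⇒¬isLeast {P = P} {u} {v} u<v u~v =
  cong not (Equivalence.to T-≡ (any⁺ earlier (lose (∈-allFin u) u-earlier)))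
  where
  earlier : Fin _ → Bool
  earlier w = (toℕ w <ᵇ toℕ v) ∧ same P w v
  u-earlier : T (earlier u)
  u-earlier = Equivalence.from T-∧ (<⇒<ᵇ u<v , Equivalence.from T-≡ u~v)

¬earlier⇒isLeast : ∀ {P : Partition n} {v} → (∀ u → toℕ u < toℕ v → same P u v ≢ true) →
                   isLeast P v ≡ true
¬earlier⇒isLeast {P = P} {v} none = cong not (¬-not (no-earlier ∘ Equivalence.from T-≡))
  where
  no-earlier : ¬ T (any (λ u → (toℕ u <ᵇ toℕ v) ∧ same P u v) (allFin _))
  no-earlier t with satisfied (any⁻ _ (allFin _) t)
  ... | u , u-earlier with Equivalence.to T-∧ u-earlier
  ... | u<v , u~v = none u (<ᵇ⇒< _ _ u<v) (Equivalence.to T-≡ u~v)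

notLeast-in-pair : ∀ {P : Partition n} {u v} → u ≢ v → same P u v ≡ true →
                   isLeast P u ≡ false ⊎ isLeast P v ≡ false
notLeast-in-pair {P = P} {u} {v} u≢v u~v with <-cmp (toℕ u) (toℕ v)
... | tri< u<v _ _ = inj₂ (earlier⇒¬isLeast {P = P} u<v u~v)
... | tri≈ _ u=v _ = ⊥-elim (u≢v (toℕ-injective u=v))
... | tri> _ _ v<u = inj₁ (earlier⇒¬isLeast {P = P} v<u (trans (same-sym P v u) u~v))

sum-map-mono : ∀ {A : Set} {f g : A → ℕ} → (∀ x → f x ≤ g x) →
               ∀ xs → sum (map f xs) ≤ sum (map g xs)
sum-map-mono f≤g List.[]       = z≤n
sum-map-mono f≤g (x List.∷ xs) = +-mono-≤ (f≤g x) (sum-map-mono f≤g xs)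

indicator-mono : ∀ {x y : Bool} → (x ≡ true → y ≡ true) → (if x then 1 else 0) ≤ (if y then 1 else 0)
indicator-mono {false} _   = z≤n
indicator-mono {true}  x⇒y rewrite x⇒y refl = ≤-refl

numParts-mono : ∀ {P Q : Partition n} →
  (∀ v → isLeast P v ≡ true → ∀ u → same Q u v ≡ true → same P u v ≡ true) →
  numParts P ≤ numParts Q
numParts-mono {P = P} {Q} keeps = sum-map-mono (λ v → indicator-mono (least-preserved v)) (allFin _)
  where
  least-preserved : ∀ v → isLeast P v ≡ true → isLeast Q v ≡ true
  least-preserved v v-least = ¬earlier⇒isLeast {P = Q} λ u u<v u~v →
    contradiction (trans (sym v-least) (earlier⇒¬isLeast {P = P} u<v (keeps v v-least u u~v))) λ ()

InB⇒Independent : ∀ {G : Graph n} {P} b → InB G b P → Independent G P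
InB⇒Independent nothing  P-independent       = P-independent
InB⇒Independent (just _) (P-independent , _) = P-independent

InB-mono : ∀ {G : Graph n} {P Q} b → InB G b P → Independent G Q → numParts P ≤ numParts Q → InB G b Q
InB-mono nothing  _         Q-independent _   = Q-independent
InB-mono (just _) (_ , k≤P) Q-independent P≤Q = Q-independent , ≤-trans k≤P P≤Q

-- Repartitioning a union of parts

module Repartition (P : Partition n) (vtx : Fin k → Fin n) (vtx-injective : Injective _≡_ _≡_ vtx) where

  InImage : Fin n → Set
  InImage v = ∃[ i ] vtx i ≡ v

  inImage? : ∀ v → Dec (InImage v)
  inImage? v = any? λ i → vtx i ≟ v

  repartitioned : Partition k → ∀ u v → Dec (InImage u) → Dec (InImage v) → Bool
  repartitioned s u v (yes (i , _)) (yes (j , _)) = same s i j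
  repartitioned s u v (no _)        (no _)        = same P u v
  repartitioned s u v _             _             = false

  repartition : Partition k → Partition n
  repartition s = record
    { same       = λ u v → repartitioned s u v (inImage? u) (inImage? v)
    ; same-refl  = λ v → refl′ v (inImage? v)
    ; same-sym   = λ u v → sym′ u v (inImage? u) (inImage? v)
    ; same-trans = λ u v w → trans′ u v w (inImage? u) (inImage? v) (inImage? w)
    }
    where
    refl′ : ∀ v dv → repartitioned s v v dv dv ≡ true
    refl′ v (yes (i , _)) = same-refl s i
    refl′ v (no _)        = same-refl P v
    sym′ : ∀ u v du dv → repartitioned s u v du dv ≡ repartitioned s v u dv du
    sym′ u v (yes (i , _)) (yes (j , _)) = same-sym s i j
    sym′ u v (yes _)       (no _)        = refl
    sym′ u v (no _)        (yes _)       = refl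
    sym′ u v (no _)        (no _)        = same-sym P u v
    trans′ : ∀ u v w du dv dw → repartitioned s u v du dv ≡ true → repartitioned s v w dv dw ≡ true →
             repartitioned s u w du dw ≡ true
    trans′ u v w (yes (i , _)) (yes (j , _)) (yes (l , _)) = same-trans s i j l
    trans′ u v w (no _)        (no _)        (no _)        = same-trans P u v w

  same-repartition-vtx : ∀ s i j → same (repartition s) (vtx i) (vtx j) ≡ same s i j
  same-repartition-vtx s i j = located (inImage? (vtx i)) (inImage? (vtx j))
    where
    located : ∀ di dj → repartitioned s (vtx i) (vtx j) di dj ≡ same s i j
    located (yes (i′ , i′↦i)) (yes (j′ , j′↦j)) =
      cong₂ (same s) (vtx-injective i′↦i) (vtx-injective j′↦j)
    located (no i∉)           _                 = ⊥-elim (i∉ (i , refl))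
    located (yes _)           (no j∉)           = ⊥-elim (j∉ (j , refl))

  repartitioned-cong : ∀ {s t u w} du dw →
                       (∀ i j → vtx i ≡ u → vtx j ≡ w → same s i j ≡ same t i j) →
                       repartitioned s u w du dw ≡ repartitioned t u w du dw
  repartitioned-cong (yes (i , i↦u)) (yes (j , j↦w)) s~t = s~t i j i↦u j↦w
  repartitioned-cong (yes _)         (no _)          _   = refl
  repartitioned-cong (no _)          (yes _)         _   = refl
  repartitioned-cong (no _)          (no _)          _   = refl

  repartition-preserves-≈ : ∀ {s t} → s ≈P t → repartition s ≈P repartition t
  repartition-preserves-≈ s≈t u v = repartitioned-cong (inImage? u) (inImage? v) λ i j _ _ → s≈t i j

  repartition-reflects-≈ : ∀ {s t} → repartition s ≈P repartition t → s ≈P t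
  repartition-reflects-≈ {s} {t} s≈t i j =
    trans (sym (same-repartition-vtx s i j))
          (trans (s≈t (vtx i) (vtx j)) (same-repartition-vtx t i j))

  repartition-preserves-AgreeOff : ∀ {s t m} → AgreeOff m s t →
                                   AgreeOff (vtx m) (repartition s) (repartition t)
  repartition-preserves-AgreeOff agree u w u≢m w≢m =
    repartitioned-cong (inImage? u) (inImage? w) λ where
      i j refl refl → agree i j (u≢m ∘ cong vtx) (w≢m ∘ cong vtx)

  AgreeOff-on-image : ∀ {s t x} → AgreeOff x (repartition s) (repartition t) →
                      ∀ i j → vtx i ≢ x → vtx j ≢ x → same s i j ≡ same t i j
  AgreeOff-on-image {s} {t} agree i j i≢x j≢x =
    trans (sym (same-repartition-vtx s i j))
          (trans (agree (vtx i) (vtx j) i≢x j≢x) (same-repartition-vtx t i j))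

  repartition-preserves-BAdj : ∀ {s t} → BAdj s t → BAdj (repartition s) (repartition t)
  repartition-preserves-BAdj (s≉t , m , agree) =
    s≉t ∘ repartition-reflects-≈ , vtx m , repartition-preserves-AgreeOff agree

  -- Off the image both partitions are P, so agreeing off a vertex outside the image means being equal.
  repartition-reflects-BAdj : ∀ {s t} → BAdj (repartition s) (repartition t) → BAdj s t
  repartition-reflects-BAdj (s≉t , x , agree) with inImage? x
  ... | yes (m , refl) =
    s≉t ∘ repartition-preserves-≈ ,
    m , λ i j i≢m j≢m → AgreeOff-on-image agree i j (i≢m ∘ vtx-injective) (j≢m ∘ vtx-injective)
  ... | no x∉ = ⊥-elim (s≉t (repartition-preserves-≈ λ i j →
                  AgreeOff-on-image agree i j (x∉ ∘ (i ,_)) (x∉ ∘ (j ,_))))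

  repartition-preserves-NonAdjacentNeighbours : ∀ {s t₁ t₂} → NonAdjacentNeighbours s t₁ t₂ →
    NonAdjacentNeighbours (repartition s) (repartition t₁) (repartition t₂)
  repartition-preserves-NonAdjacentNeighbours (nonAdjacentNeighbours st₁ st₂ t₁≉t₂ t₁≁t₂) =
    nonAdjacentNeighbours (repartition-preserves-BAdj st₁) (repartition-preserves-BAdj st₂)
                          (t₁≉t₂ ∘ repartition-reflects-≈) (t₁≁t₂ ∘ repartition-reflects-BAdj)

  repartition-preserves-OutsideCommonNeighbour : ∀ {s t₁ t₂ r} → OutsideCommonNeighbour s t₁ t₂ r →
    OutsideCommonNeighbour (repartition s) (repartition t₁) (repartition t₂) (repartition r)
  repartition-preserves-OutsideCommonNeighbour (outsideCommonNeighbour r≉s s≁r t₁r t₂r) =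
    outsideCommonNeighbour (r≉s ∘ repartition-reflects-≈) (s≁r ∘ repartition-reflects-BAdj)
                           (repartition-preserves-BAdj t₁r) (repartition-preserves-BAdj t₂r)

  ≈P-repartition : ∀ {s} → (∀ i j → same P (vtx i) (vtx j) ≡ same s i j) →
                   (∀ i v → same P (vtx i) v ≡ true → InImage v) → P ≈P repartition s
  ≈P-repartition {s} P-on-image image-closed u v = go u v (inImage? u) (inImage? v)
    where
    outside : ∀ i {v} → ¬ InImage v → same P (vtx i) v ≡ false
    outside i v∉ = ¬-not (v∉ ∘ image-closed i _)
    go : ∀ u v du dv → same P u v ≡ repartitioned s u v du dv
    go _ _ (yes (i , refl)) (yes (j , refl)) = P-on-image i j
    go _ v (yes (i , refl)) (no v∉)          = outside i v∉
    go u _ (no u∉)          (yes (j , refl)) = trans (same-sym P u (vtx j)) (outside j u∉)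
    go _ _ (no _)           (no _)           = refl

  repartition-independent : ∀ {G : Graph n} {s} → Independent G P →
    (∀ i j → same s i j ≡ true → E G (vtx i) (vtx j) ≡ false) → Independent G (repartition s)
  repartition-independent {G = G} {s} P-independent s-independent u v = go u v (inImage? u) (inImage? v)
    where
    go : ∀ u v du dv → repartitioned s u v du dv ≡ true → E G u v ≡ false
    go _ _ (yes (i , refl)) (yes (j , refl)) = s-independent i j
    go u v (no _)           (no _)           = P-independent u v

  numParts-repartition : ∀ {s} →
    (∀ i j → isLeast P (vtx i) ≡ true → same s j i ≡ true → same P (vtx j) (vtx i) ≡ true) →
    numParts P ≤ numParts (repartition s)
  numParts-repartition {s} least-parts-kept =
    numParts-mono {P = P} {repartition s} λ v v-least u → go u v (inImage? u) (inImage? v) v-least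
    where
    go : ∀ u v du dv → isLeast P v ≡ true → repartitioned s u v du dv ≡ true → same P u v ≡ true
    go _ _ (yes (j , refl)) (yes (i , refl)) i-least = least-parts-kept i j i-least
    go u v (no _)           (no _)           _       = id

kernel : (Fin k → ℕ) → Partition k
kernel f = record
  { same       = λ u v → does (f u ℕ.≟ f v)
  ; same-refl  = λ v → dec-true (f v ℕ.≟ f v) refl
  ; same-sym   = λ u v → does-⇔ (mk⇔ sym sym) (f u ℕ.≟ f v) (f v ℕ.≟ f u)
  ; same-trans = λ u v w → does-trans (f u ℕ.≟ f v) (f v ℕ.≟ f w) (f u ℕ.≟ f w)
  }
  where
  does-trans : ∀ {x y z : ℕ} (x≟y : Dec (x ≡ y)) (y≟z : Dec (y ≡ z)) (x≟z : Dec (x ≡ z)) →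
               does x≟y ≡ true → does y≟z ≡ true → does x≟z ≡ true
  does-trans (yes x≡y) (yes y≡z) x≟z _ _ = dec-true x≟z (trans x≡y y≡z)

RefinesOff : Fin k → Fin k → Partition k → Partition k → Set
RefinesOff x y s t = ∀ i j → i ≢ x → i ≢ y → same s j i ≡ true → same t j i ≡ true

refinesOff? : (x y : Fin k) (s t : Partition k) → Dec (RefinesOff x y s t)
refinesOff? x y s t = all? λ i → all? λ j →
  ¬? (i ≟ x) →-dec ¬? (i ≟ y) →-dec (same s j i Bool.≟ true) →-dec (same t j i Bool.≟ true)

-- 0F, 1F, 2F, 3F stand for a, b, c, d.
p q₁ q₂ r₁ : Partition 4
p  = kernel (0 ∷ 0 ∷ 1 ∷ 1 ∷ [])
q₁ = kernel (0 ∷ 1 ∷ 2 ∷ 2 ∷ [])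
q₂ = kernel (0 ∷ 0 ∷ 2 ∷ 3 ∷ [])
r₁ = kernel toℕ

r₂ : Fin 4 → Fin 4 → Partition 4
r₂ x y = kernel λ v → toℕ (if does (v ≟ y) then x else v)

q₁-q₂-nonAdjacentNeighbours : NonAdjacentNeighbours p q₁ q₂
q₁-q₂-nonAdjacentNeighbours = from-yes (nonAdjacentNeighbours? p q₁ q₂)

r₁-outsideCommonNeighbour : OutsideCommonNeighbour p q₁ q₂ r₁
r₁-outsideCommonNeighbour = from-yes (outsideCommonNeighbour? p q₁ q₂ r₁)

r₂-outsideCommonNeighbour : ∀ x y → same p 0F x ≡ true → same p 2F y ≡ true →
  OutsideCommonNeighbour p q₁ q₂ (r₂ x y) × ¬ (r₁ ≈P r₂ x y)
r₂-outsideCommonNeighbour = from-yes (all? λ x → all? λ y →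
  (same p 0F x Bool.≟ true) →-dec (same p 2F y Bool.≟ true) →-dec
  outsideCommonNeighbour? p q₁ q₂ (r₂ x y) ×-dec ¬? (r₁ ≈P? r₂ x y))

refinesOff-p : ∀ x y → same p 0F x ≡ true → same p 2F y ≡ true →
  RefinesOff x y q₁ p × RefinesOff x y q₂ p × RefinesOff x y r₁ p × RefinesOff x y (r₂ x y) p
refinesOff-p = from-yes (all? λ x → all? λ y →
  (same p 0F x Bool.≟ true) →-dec (same p 2F y Bool.≟ true) →-dec
  refinesOff? x y q₁ p ×-dec refinesOff? x y q₂ p ×-dec
  refinesOff? x y r₁ p ×-dec refinesOff? x y (r₂ x y) p)

same-false-resp : ∀ {P : Partition n} {u u′ v v′} → same P u u′ ≡ true → same P v v′ ≡ true →
                  same P u v ≡ false → same P u′ v′ ≡ false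
same-false-resp {P = P} {u} {u′} {v} {v′} u~u′ v~v′ u≁v = ¬-not λ u′~v′ →
  contradiction (trans (sym (same-trans P u u′ v u~u′ (same-trans P u′ v′ v u′~v′ v′~v))) u≁v) λ ()
  where
  v′~v : same P v′ v ≡ true
  v′~v = trans (same-sym P v′ v) v~v′

module TwoPairs {G : Graph n} {P : Partition n} (P-independent : Independent G P) {a b c d : Fin n}
  (a≢b : a ≢ b) (a~b : same P a b ≡ true) (a-part : ∀ v → same P a v ≡ true → v ≡ a ⊎ v ≡ b)
  (c≢d : c ≢ d) (c~d : same P c d ≡ true) (c-part : ∀ v → same P c v ≡ true → v ≡ c ⊎ v ≡ d)
  (a≁c : same P a c ≡ false)
  (a-c : E G a c ≡ false) (a-d : E G a d ≡ false) (b-c : E G b c ≡ false) (b-d : E G b d ≡ false) where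

  vtx : Fin 4 → Fin n
  vtx = a ∷ b ∷ c ∷ d ∷ []

  same-vtx : ∀ i j → same P (vtx i) (vtx j) ≡ same p i j
  same-vtx 0F 0F = same-refl P a
  same-vtx 0F 1F = a~b
  same-vtx 0F 2F = a≁c
  same-vtx 0F 3F = same-false-resp {P = P} (same-refl P a) c~d a≁c
  same-vtx 1F 0F = trans (same-sym P b a) a~b
  same-vtx 1F 1F = same-refl P b
  same-vtx 1F 2F = same-false-resp {P = P} a~b (same-refl P c) a≁c
  same-vtx 1F 3F = same-false-resp {P = P} a~b c~d a≁c
  same-vtx 2F 0F = trans (same-sym P c a) (same-vtx 0F 2F)
  same-vtx 2F 1F = trans (same-sym P c b) (same-vtx 1F 2F)
  same-vtx 2F 2F = same-refl P c
  same-vtx 2F 3F = c~d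
  same-vtx 3F 0F = trans (same-sym P d a) (same-vtx 0F 3F)
  same-vtx 3F 1F = trans (same-sym P d b) (same-vtx 1F 3F)
  same-vtx 3F 2F = trans (same-sym P d c) c~d
  same-vtx 3F 3F = same-refl P d

  separated : ∀ i j → same p i j ≡ false → vtx i ≢ vtx j
  separated i j i≁j vi≡vj = contradiction
    (trans (sym (same-refl P (vtx i))) (trans (cong (same P (vtx i)) vi≡vj) (trans (same-vtx i j) i≁j))) λ ()

  vtx-injective : Injective _≡_ _≡_ vtx
  vtx-injective {0F} {0F} _ = refl
  vtx-injective {0F} {1F}   = ⊥-elim ∘ a≢b
  vtx-injective {0F} {2F}   = ⊥-elim ∘ separated 0F 2F refl
  vtx-injective {0F} {3F}   = ⊥-elim ∘ separated 0F 3F refl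
  vtx-injective {1F} {0F}   = ⊥-elim ∘ a≢b ∘ sym
  vtx-injective {1F} {1F} _ = refl
  vtx-injective {1F} {2F}   = ⊥-elim ∘ separated 1F 2F refl
  vtx-injective {1F} {3F}   = ⊥-elim ∘ separated 1F 3F refl
  vtx-injective {2F} {0F}   = ⊥-elim ∘ separated 2F 0F refl
  vtx-injective {2F} {1F}   = ⊥-elim ∘ separated 2F 1F refl
  vtx-injective {2F} {2F} _ = refl
  vtx-injective {2F} {3F}   = ⊥-elim ∘ c≢d
  vtx-injective {3F} {0F}   = ⊥-elim ∘ separated 3F 0F refl
  vtx-injective {3F} {1F}   = ⊥-elim ∘ separated 3F 1F refl
  vtx-injective {3F} {2F}   = ⊥-elim ∘ c≢d ∘ sym
  vtx-injective {3F} {3F} _ = refl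

  image-independent : ∀ i j → E G (vtx i) (vtx j) ≡ false
  image-independent 0F 2F = a-c
  image-independent 0F 3F = a-d
  image-independent 1F 2F = b-c
  image-independent 1F 3F = b-d
  image-independent 2F 0F = trans (E-sym G c a) a-c
  image-independent 3F 0F = trans (E-sym G d a) a-d
  image-independent 2F 1F = trans (E-sym G c b) b-c
  image-independent 3F 1F = trans (E-sym G d b) b-d
  image-independent 0F 0F = P-independent a a (same-vtx 0F 0F)
  image-independent 0F 1F = P-independent a b (same-vtx 0F 1F)
  image-independent 1F 0F = P-independent b a (same-vtx 1F 0F)
  image-independent 1F 1F = P-independent b b (same-vtx 1F 1F)
  image-independent 2F 2F = P-independent c c (same-vtx 2F 2F)
  image-independent 2F 3F = P-independent c d (same-vtx 2F 3F)
  image-independent 3F 2F = P-independent d c (same-vtx 3F 2F)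
  image-independent 3F 3F = P-independent d d (same-vtx 3F 3F)

  open Repartition P vtx vtx-injective

  image-closed : ∀ i v → same P (vtx i) v ≡ true → InImage v
  image-closed 0F v a~v = [ (λ v≡a → 0F , sym v≡a) , (λ v≡b → 1F , sym v≡b) ]′ (a-part v a~v)
  image-closed 1F v b~v = image-closed 0F v (same-trans P a b v a~b b~v)
  image-closed 2F v c~v = [ (λ v≡c → 2F , sym v≡c) , (λ v≡d → 3F , sym v≡d) ]′ (c-part v c~v)
  image-closed 3F v d~v = image-closed 2F v (same-trans P c d v c~d d~v)

  P≈repartition-p : P ≈P repartition p
  P≈repartition-p = ≈P-repartition same-vtx image-closed

  repartition-p≈P : repartition p ≈P P
  repartition-p≈P u v = sym (P≈repartition-p u v)

  notLeast-ab : ∃[ x ] same p 0F x ≡ true × isLeast P (vtx x) ≡ false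
  notLeast-ab = [ (λ a-notLeast → 0F , refl , a-notLeast) , (λ b-notLeast → 1F , refl , b-notLeast) ]′
                  (notLeast-in-pair {P = P} a≢b a~b)

  notLeast-cd : ∃[ y ] same p 2F y ≡ true × isLeast P (vtx y) ≡ false
  notLeast-cd = [ (λ c-notLeast → 2F , refl , c-notLeast) , (λ d-notLeast → 3F , refl , d-notLeast) ]′
                  (notLeast-in-pair {P = P} c≢d c~d)

  least≢notLeast : ∀ {i z} → isLeast P (vtx i) ≡ true → isLeast P (vtx z) ≡ false → i ≢ z
  least≢notLeast i-least z-notLeast refl = contradiction (trans (sym i-least) z-notLeast) λ ()

  repartition∈B : ∀ {β x y s} → InB G β P → isLeast P (vtx x) ≡ false → isLeast P (vtx y) ≡ false →
                  RefinesOff x y s p → InB G β (repartition s)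
  repartition∈B {β} {x} {y} {s} P∈B x-notLeast y-notLeast s-refines = InB-mono β P∈B
    (repartition-independent {G = G} {s} P-independent λ i j _ → image-independent i j)
    (numParts-repartition {s} λ i j i-least j~i →
      trans (same-vtx j i)
            (s-refines i j (least≢notLeast i-least x-notLeast) (least≢notLeast i-least y-notLeast) j~i))

  lift-outsideCommonNeighbour : ∀ {r} → OutsideCommonNeighbour p q₁ q₂ r →
    OutsideCommonNeighbour P (repartition q₁) (repartition q₂) (repartition r)
  lift-outsideCommonNeighbour =
    outsideCommonNeighbour-respˡ repartition-p≈P ∘ repartition-preserves-OutsideCommonNeighbour

  ¬Property1-given-notLeast : ∀ {β x y} → InB G β P →
    isLeast P (vtx x) ≡ false → isLeast P (vtx y) ≡ false →
    RefinesOff x y q₁ p × RefinesOff x y q₂ p × RefinesOff x y r₁ p × RefinesOff x y (r₂ x y) p →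
    OutsideCommonNeighbour p q₁ q₂ (r₂ x y) × ¬ (r₁ ≈P r₂ x y) →
    ¬ Property1 G β P
  ¬Property1-given-notLeast {β} {x} {y} P∈B x-notLeast y-notLeast
    (q₁-refines , q₂-refines , r₁-refines , r₂-refines) (r₂-outside , r₁≉r₂) =
    outsideCommonNeighbours⇒¬Property1
      (∈B q₁-refines) (∈B q₂-refines)
      (nonAdjacentNeighbours-respˡ repartition-p≈P
        (repartition-preserves-NonAdjacentNeighbours q₁-q₂-nonAdjacentNeighbours))
      (∈B r₁-refines) (∈B r₂-refines)
      (lift-outsideCommonNeighbour r₁-outsideCommonNeighbour) (lift-outsideCommonNeighbour r₂-outside)
      (r₁≉r₂ ∘ repartition-reflects-≈)
    where
    ∈B : ∀ {s} → RefinesOff x y s p → InB G β (repartition s)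
    ∈B = repartition∈B P∈B x-notLeast y-notLeast

  ¬Property1 : ∀ {β} → InB G β P → ¬ Property1 G β P
  ¬Property1 P∈B =
    let x , 0~x , x-notLeast = notLeast-ab
        y , 2~y , y-notLeast = notLeast-cd
    in ¬Property1-given-notLeast P∈B x-notLeast y-notLeast
         (refinesOff-p x y 0~x 2~y) (r₂-outsideCommonNeighbour x y 0~x 2~y)

lemma2p5 : (n : ℕ) (G : Graph n) (b : Maybe ℕ) → ValidVariant n b →
    (P : Partition n) → InB G b P → TwoNonAdjacentPairs G P → ¬ Property1 G b P
lemma2p5 n G β _ P P∈B
  (a , b , c , d , (a≢b , a~b , a-part) , (c≢d , c~d , c-part) , a≁c , a-c , a-d , b-c , b-d) =
  TwoPairs.¬Property1 (InB⇒Independent β P∈B)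
    a≢b a~b a-part c≢d c~d c-part a≁c a-c a-d b-c b-d P∈B
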